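{- Let $n$ be a positive integer, and let $p$ and $q$ be distinct odd primes not dividing $n$. Then $pq=x^2+ny^2$ for some $x,y\in\mathbb{Z}$ if and only if there is a reduced form of discriminant $-4n$ which represents both $p$ and $q$.
   Context: A form is an integral binary quadratic form $f(x,y)=ax^2+bxy+cy^2$ with $a,b,c\in\mathbb{Z}$; its discriminant is $b^2-4ac$. It is primitive if $\gcd(a,b,c)=1$. An integer $m$ is represented by $f$ if $m=f(x,y)$ for some $x,y\in\mathbb{Z}$. A reduced form is a primitive positive definite form $ax^2+bxy+cy^2$ whose coefficients satisfy $|b|\le a\le c$, and $b\ge 0$ if either $|b|=a$ or $a=c$. -}

module Defs where

open import Data.Nat as ℕ using (ℕ)
import Data.Nat.GCD as ℕG
open import Data.Integer using (ℤ; +_; _+_; _-_; _*_; ∣_∣; _≤_; _<_; 0ℤ)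
open import Data.Product using (_×_; Σ; ∃-syntax; _,_)
open import Data.Sum using (_⊎_)
open import Relation.Binary.PropositionalEquality using (_≡_; _≢_)

record Form : Set where
  constructor form
  field
    a b c : ℤ
open Form public

eval : Form → ℤ → ℤ → ℤ
eval f x y = a f * (x * x) + b f * (x * y) + c f * (y * y)

disc : Form → ℤ
disc f = b f * b f - + 4 * a f * c f

Primitive : Form → Set
Primitive f = ℕG.gcd (ℕG.gcd ∣ a f ∣ ∣ b f ∣) ∣ c f ∣ ≡ 1

PositiveDefinite : Form → Set
PositiveDefinite f = ∀ (x y : ℤ) → (x ≢ 0ℤ ⊎ y ≢ 0ℤ) → 0ℤ < eval f x y

Reduced : Form → Set
Reduced f =
  Primitive f × PositiveDefinite f ×
  (+ ∣ b f ∣ ≤ a f) × (a f ≤ c f) ×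
  ((+ ∣ b f ∣ ≡ a f ⊎ a f ≡ c f) → 0ℤ ≤ b f)

Represents : Form → ℤ → Set
Represents f m = ∃[ x ] ∃[ y ] (m ≡ eval f x y)

module Submission where

-- For n > 0 and distinct primes p, q:
--   pq = x² + n y²  ⇔  some reduced form of discriminant −4n represents p and q.
--
-- (⇐) Discriminant −4n forces an even middle coefficient, so the form is
--     A x² + 2h xy + C y² with AC − h² = n, and the composition identity
--     (A x₁² + 2h x₁y₁ + C y₁²)(A x₂² + 2h x₂y₂ + C y₂²) = X² + (AC − h²) Y²
--     writes pq = x² + n y².
-- (⇒) From pq = x² + n y² we get p ∤ y, hence u p + v y = 1 (Bézout).  Then
--     B = x v satisfies p C = B² + n for an explicit C, and the form (p, 2B, C)
--     has discriminant −4n, is positive definite (p·f(s,t) = (ps + Bt)² + n t²)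
--     and takes the values p = f(1,0), q = f(xu, y).  Lagrange–Gauss reduction,
--     built from the substitutions x ↦ x + ky and (x, y) ↦ (−y, x), carries it
--     to a form of reduced shape still representing p and q; a form representing
--     two coprime numbers is primitive.

open import Defs
open import Data.Nat using (ℕ; NonZero)
open import Data.Nat.Divisibility using (_∣_)
open import Data.Nat.Primality using (Prime)
open import Data.Integer using (ℤ; +_; -_; _+_; _*_)
open import Data.Product using (_×_; ∃-syntax)
open import Function.Bundles using (_⇔_)
open import Relation.Binary.PropositionalEquality using (_≡_; _≢_)
open import Relation.Nullary using (¬_)

import Data.Nat as ℕ
import Data.Nat.Properties as ℕP
import Data.Nat.Divisibility as ℕD
open import Data.Nat.Primality using (euclidsLemma; prime⇒irreducible; prime⇒nonZero; ¬prime[1])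
open import Data.Nat.GCD using (gcd; gcd[m,n]∣m; gcd[m,n]∣n; module Bézout)
open import Data.Nat.Coprimality using (Coprime; coprime-Bézout)
open import Data.Nat.Induction using (<-wellFounded)
open import Induction.WellFounded using (Acc; acc)
open import Data.Integer using (0ℤ; -[1+_]; +[1+_]; ∣_∣; _-_; _≤_; _<_; +≤+; +<+)
open import Data.Integer.Properties
  using ( _≟_; _≤?_; _<?_; ≤-reflexive; <⇒≤; ≮⇒≥; ≰⇒>; <-trans; <-irrefl
        ; neg-mono-<; neg-cancel-<; +-mono-≤-<; neg-involutive; neg-injective; +-monoʳ-<; i-j≤i
        ; pos-+; pos-*; abs-*; +-injective; +-comm; +-identityˡ; +-identityʳ; *-comm; *-zeroʳ
        ; *-cancelˡ-≡; *-cancelˡ-<-nonNeg; i*j≡0⇒i≡0∨j≡0 )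
import Data.Integer.Divisibility.Signed as ℤD
open import Data.Integer.DivMod using (_/ℕ_; _%ℕ_; a≡a%ℕn+[a/ℕn]*n; n%ℕd<d)
open import Data.Integer.Tactic.RingSolver using (solve-∀)
open import Data.Product using (_,_)
open import Data.Sum using (_⊎_; inj₁; inj₂; [_,_]′)
open import Data.Empty using (⊥-elim)
open import Function using (id)
open import Function.Bundles using (mk⇔)
open import Relation.Binary.PropositionalEquality
  using (refl; sym; trans; cong; cong₂; subst; subst₂; module ≡-Reasoning)
open import Relation.Nullary using (yes; no)

square-abs : ∀ i → i * i ≡ + (∣ i ∣ ℕ.* ∣ i ∣)
square-abs (+ n)    = sym (pos-* n n)
square-abs -[1+ n ] = refl

square-nonneg : ∀ i → 0ℤ ≤ i * i
square-nonneg i = subst (0ℤ ≤_) (sym (square-abs i)) (+≤+ ℕ.z≤n)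

square-pos : ∀ {i} → i ≢ 0ℤ → 0ℤ < i * i
square-pos {+ ℕ.zero}  i≢0 = ⊥-elim (i≢0 refl)
square-pos {+[1+ n ]}  _   = +<+ ℕ.z<s
square-pos { -[1+ n ]} _   = +<+ ℕ.z<s

*-pos : ∀ {i j} → 0ℤ < i → 0ℤ < j → 0ℤ < i * j
*-pos {+[1+ m ]} {+[1+ n ]} _ _ = +<+ ℕ.z<s
*-pos {+ ℕ.zero} (+<+ ())
*-pos {+[1+ m ]} {+ ℕ.zero} _ (+<+ ())

pos-cancel : ∀ p e → 0ℤ < + p * e → 0ℤ < e
pos-cancel p e pe>0 = *-cancelˡ-<-nonNeg (+ p) (subst (_< + p * e) (sym (*-zeroʳ (+ p))) pe>0)

norm-pos : ∀ {N} u t → 0ℤ < N → (u ≢ 0ℤ ⊎ t ≢ 0ℤ) → 0ℤ < u * u + N * (t * t)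
norm-pos {N} u t N>0 nonzero with t ≟ 0ℤ | nonzero
... | no t≢0  | _        = +-mono-≤-< (square-nonneg u) (*-pos N>0 (square-pos t≢0))
... | yes refl | inj₁ u≢0 = subst (0ℤ <_) (sym drop-zero) (square-pos u≢0)
  where
  drop-zero : u * u + N * 0ℤ ≡ u * u
  drop-zero = trans (cong (λ z → u * u + z) (*-zeroʳ N)) (+-identityʳ (u * u))
... | yes refl | inj₂ t≢0 = ⊥-elim (t≢0 refl)

one≢even : ∀ w → + 1 ≢ + 2 * w
one≢even w 1≡2w = ℕP.even≢odd ∣ w ∣ 0 (sym (trans (cong ∣_∣ 1≡2w) (abs-* (+ 2) w)))

-- For 0 < i < j also ∣i∣ < ∣j∣; this is the termination measure of reduction.
abs-mono-< : ∀ {i j} → 0ℤ < i → i < j → ∣ i ∣ ℕ.< ∣ j ∣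
abs-mono-< {+ m} {+ n} _ (+<+ m<n) = m<n

-- The substitution x ↦ x + k y, acting on coefficients.
translate : ℤ → Form → Form
translate k f = form (a f) (b f + + 2 * k * a f) (a f * (k * k) + b f * k + c f)

-- The substitution (x, y) ↦ (−y, x), acting on coefficients.
swap : Form → Form
swap f = form (c f) (- b f) (a f)

-- f ↝ g: g is obtained from f by invertible integral substitutions.  We keep
-- the three consequences the proof uses.
record _↝_ (f g : Form) : Set where
  field
    disc-≡       : disc g ≡ disc f
    pd-↝         : PositiveDefinite f → PositiveDefinite g
    represents-↝ : ∀ {m} → Represents f m → Represents g m
open _↝_

↝-refl : ∀ {f} → f ↝ f
↝-refl = record { disc-≡ = refl ; pd-↝ = id ; represents-↝ = id }

↝-trans : ∀ {f g h} → f ↝ g → g ↝ h → f ↝ h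
↝-trans f↝g g↝h = record
  { disc-≡       = trans (disc-≡ g↝h) (disc-≡ f↝g)
  ; pd-↝         = λ pd → pd-↝ g↝h (pd-↝ f↝g pd)
  ; represents-↝ = λ r → represents-↝ g↝h (represents-↝ f↝g r)
  }

pd-pullback : ∀ {f g} (σ τ : ℤ → ℤ → ℤ) →
  (∀ x y → eval g x y ≡ eval f (σ x y) (τ x y)) →
  (∀ x y → σ x y ≡ 0ℤ → τ x y ≡ 0ℤ → x ≡ 0ℤ × y ≡ 0ℤ) →
  PositiveDefinite f → PositiveDefinite g
pd-pullback σ τ eval-g kernel pd x y nonzero =
  subst (0ℤ <_) (sym (eval-g x y)) (pd (σ x y) (τ x y) (image-nonzero nonzero))
  where
  image-nonzero : x ≢ 0ℤ ⊎ y ≢ 0ℤ → σ x y ≢ 0ℤ ⊎ τ x y ≢ 0ℤ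
  image-nonzero x-or-y with σ x y ≟ 0ℤ | τ x y ≟ 0ℤ
  ... | no σ≢0  | _        = inj₁ σ≢0
  ... | yes _   | no τ≢0   = inj₂ τ≢0
  ... | yes σ≡0 | yes τ≡0 with kernel x y σ≡0 τ≡0 | x-or-y
  ...   | x≡0 , _   | inj₁ x≢0 = ⊥-elim (x≢0 x≡0)
  ...   | _   , y≡0 | inj₂ y≢0 = ⊥-elim (y≢0 y≡0)

translate↝ : ∀ k f → f ↝ translate k f
translate↝ k f = record
  { disc-≡       = translate-disc (a f) (b f) (c f) k
  ; pd-↝         = pd-pullback {f} {translate k f} (λ x y → x + k * y) (λ _ y → y)
                     (translate-eval (a f) (b f) (c f) k) kernel
  ; represents-↝ = λ { (x , y , m≡) →
      x - k * y , y , trans m≡ (sym (translate-eval⁻¹ (a f) (b f) (c f) k x y)) }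
  }
  where
  kernel : ∀ x y → x + k * y ≡ 0ℤ → y ≡ 0ℤ → x ≡ 0ℤ × y ≡ 0ℤ
  kernel x y x+ky≡0 refl = trans (sym (trans (cong (λ z → x + z) (*-zeroʳ k)) (+-identityʳ x))) x+ky≡0 , refl
  translate-eval : ∀ A B C k x y →
    A * (x * x) + (B + + 2 * k * A) * (x * y) + (A * (k * k) + B * k + C) * (y * y)
    ≡ A * ((x + k * y) * (x + k * y)) + B * ((x + k * y) * y) + C * (y * y)
  translate-eval = solve-∀
  translate-eval⁻¹ : ∀ A B C k x y →
    A * ((x - k * y) * (x - k * y)) + (B + + 2 * k * A) * ((x - k * y) * y)
      + (A * (k * k) + B * k + C) * (y * y)
    ≡ A * (x * x) + B * (x * y) + C * (y * y)
  translate-eval⁻¹ = solve-∀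
  translate-disc : ∀ A B C k →
    (B + + 2 * k * A) * (B + + 2 * k * A) - + 4 * A * (A * (k * k) + B * k + C)
    ≡ B * B - + 4 * A * C
  translate-disc = solve-∀

swap↝ : ∀ f → f ↝ swap f
swap↝ f = record
  { disc-≡       = swap-disc (a f) (b f) (c f)
  ; pd-↝         = pd-pullback {f} {swap f} (λ _ y → - y) (λ x _ → x) (swap-eval (a f) (b f) (c f)) kernel
  ; represents-↝ = λ { (x , y , m≡) → y , - x , trans m≡ (sym (swap-eval⁻¹ (a f) (b f) (c f) x y)) }
  }
  where
  kernel : ∀ x y → - y ≡ 0ℤ → x ≡ 0ℤ → x ≡ 0ℤ × y ≡ 0ℤ
  kernel x y -y≡0 x≡0 = x≡0 , neg-injective -y≡0
  swap-eval : ∀ A B C x y →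
    C * (x * x) + (- B) * (x * y) + A * (y * y) ≡ A * ((- y) * (- y)) + B * ((- y) * x) + C * (x * x)
  swap-eval = solve-∀
  swap-eval⁻¹ : ∀ A B C x y →
    C * (y * y) + (- B) * (y * (- x)) + A * ((- x) * (- x)) ≡ A * (x * x) + B * (x * y) + C * (y * y)
  swap-eval⁻¹ = solve-∀
  swap-disc : ∀ A B C → (- B) * (- B) - + 4 * C * A ≡ B * B - + 4 * A * C
  swap-disc = solve-∀

ReducedShape : Form → Set
ReducedShape f =
  (+ ∣ b f ∣ ≤ a f) × (a f ≤ c f) × ((+ ∣ b f ∣ ≡ a f ⊎ a f ≡ c f) → 0ℤ ≤ b f)

Reducible : Form → Set
Reducible f = ∃[ g ] (f ↝ g × ReducedShape g)

↝-reducible : ∀ {f g} → f ↝ g → Reducible g → Reducible f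
↝-reducible f↝g (h , g↝h , shape) = h , ↝-trans f↝g g↝h , shape

eval-at-1,0 : ∀ A B C → A * (+ 1 * + 1) + B * (+ 1 * + 0) + C * (+ 0 * + 0) ≡ A
eval-at-1,0 = solve-∀

leading-pos : ∀ f → PositiveDefinite f → 0ℤ < a f
leading-pos f pd = subst (0ℤ <_) (eval-at-1,0 (a f) (b f) (c f)) (pd (+ 1) (+ 0) (inj₁ λ ()))

window : ∀ A B → 0ℤ < A → ∃[ k ] (- A < B + + 2 * k * A × B + + 2 * k * A ≤ A)
window (+ ℕ.zero) B (+<+ ())
window A@(+[1+ m ]) B _ = k , lower , upper
  where
  open ≡-Reasoning
  d r : ℕ
  d = 2 ℕ.* ℕ.suc m
  r = (A - B) %ℕ d
  k : ℤ
  k = (A - B) /ℕ d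
  division : A - B ≡ + r + k * (+ 2 * A)
  division = trans (a≡a%ℕn+[a/ℕn]*n (A - B) d) (cong (λ e → + r + k * e) (pos-* 2 (ℕ.suc m)))
  shift-by-rest : ∀ A B k → B + + 2 * k * A ≡ A - ((A - B) - k * (+ 2 * A))
  shift-by-rest = solve-∀
  cancel-quotient : ∀ A r k → A - ((r + k * (+ 2 * A)) - k * (+ 2 * A)) ≡ A - r
  cancel-quotient = solve-∀
  shifted : B + + 2 * k * A ≡ A - + r
  shifted = begin
    B + + 2 * k * A
      ≡⟨ shift-by-rest A B k ⟩
    A - ((A - B) - k * (+ 2 * A))
      ≡⟨ cong (λ e → A - (e - k * (+ 2 * A))) division ⟩
    A - ((+ r + k * (+ 2 * A)) - k * (+ 2 * A))
      ≡⟨ cancel-quotient A (+ r) k ⟩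
    A - + r ∎
  r<2A : + r < + 2 * A
  r<2A = subst (+ r <_) (pos-* 2 (ℕ.suc m)) (+<+ (n%ℕd<d (A - B) d))
  minus-twice : ∀ A → - A ≡ A - + 2 * A
  minus-twice = solve-∀
  lower : - A < B + + 2 * k * A
  lower = subst₂ _<_ (sym (minus-twice A)) (sym shifted) (+-monoʳ-< A (neg-mono-< r<2A))
  upper : B + + 2 * k * A ≤ A
  upper = subst (_≤ A) (sym shifted) (i-j≤i A (+ r))

-- A form with −a < b ≤ a ≤ c has reduced shape provided b ≥ 0 when a = c
-- (the window already excludes b = −a).
window⇒shape : ∀ {A B C} → - A < B → B ≤ A → A ≤ C → (A ≡ C → 0ℤ ≤ B) → ReducedShape (form A B C)
window⇒shape {B = + n} _ B≤A A≤C _ = B≤A , A≤C , λ _ → +≤+ ℕ.z≤n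
window⇒shape {A} {B = -[1+ n ]} {C} -A<B _ A≤C tie = <⇒≤ -B<A , A≤C , sign
  where
  -B<A : + ℕ.suc n < A
  -B<A = neg-cancel-< -A<B
  sign : (+ ℕ.suc n ≡ A ⊎ A ≡ C) → 0ℤ ≤ -[1+ n ]
  sign (inj₁ refl) = ⊥-elim (<-irrefl refl -B<A)
  sign (inj₂ A≡C)  = tie A≡C

centre : ∀ f → 0ℤ < a f → ∃[ k ] (- a f < b (translate k f) × b (translate k f) ≤ a f)
centre f = window (a f) (b f)

-- A centred form with a ≤ c is reducible: it is reduced, unless a = c and
-- b < 0, in which case swapping flips the sign of b.
settle : ∀ f → - a f < b f → b f ≤ a f → a f ≤ c f → Reducible f
settle f lower upper a≤c with 0ℤ ≤? b f | a f ≟ c f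
... | yes 0≤b | _       = f , ↝-refl , window⇒shape lower upper a≤c (λ _ → 0≤b)
... | no _    | no a≢c  = f , ↝-refl , window⇒shape lower upper a≤c (λ a≡c → ⊥-elim (a≢c a≡c))
... | no 0≰b  | yes a≡c =
  swap f , swap↝ f , window⇒shape lower′ upper′ (≤-reflexive (sym a≡c)) (λ _ → <⇒≤ (neg-mono-< b<0))
  where
  b<0 : b f < 0ℤ
  b<0 = ≰⇒> 0≰b
  a>0 : 0ℤ < a f
  a>0 = neg-cancel-< (<-trans lower b<0)
  -b<a : - b f < a f
  -b<a = subst (- b f <_) (neg-involutive (a f)) (neg-mono-< lower)
  lower′ : - c f < - b f
  lower′ = neg-mono-< (subst (b f <_) a≡c (<-trans b<0 a>0))
  upper′ : - b f ≤ c f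
  upper′ = subst (- b f ≤_) a≡c (<⇒≤ -b<a)

-- Reduction, by well-founded recursion on |a|: centre b; if then c < a, swap
-- (which makes c the new, smaller, leading coefficient) and recurse.
reduce-acc : ∀ f → PositiveDefinite f → Acc ℕ._<_ ∣ a f ∣ → Reducible f
reduce-acc f pd (acc smaller) with centre f (leading-pos f pd)
... | k , lower , upper with c (translate k f) <? a f
...   | no c≮a  = ↝-reducible (translate↝ k f) (settle (translate k f) lower upper (≮⇒≥ c≮a))
...   | yes c<a = ↝-reducible f↝f′ (reduce-acc f′ pd′ (smaller (abs-mono-< (leading-pos f′ pd′) c<a)))
  where
  f′ : Form
  f′ = swap (translate k f)
  f↝f′ : f ↝ f′
  f↝f′ = ↝-trans (translate↝ k f) (swap↝ (translate k f))
  pd′ : PositiveDefinite f′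
  pd′ = pd-↝ f↝f′ pd

reduce : ∀ f → PositiveDefinite f → Reducible f
reduce f pd = reduce-acc f pd (<-wellFounded ∣ a f ∣)

prime∤⇒coprime : ∀ {p m} → Prime p → ¬ p ∣ m → Coprime p m
prime∤⇒coprime pp p∤m (i∣p , i∣m) with prime⇒irreducible pp i∣p
... | inj₁ i≡1 = i≡1
... | inj₂ refl = ⊥-elim (p∤m i∣m)

prime∤prime : ∀ {p q} → Prime p → Prime q → p ≢ q → ¬ p ∣ q
prime∤prime pp pq p≢q p∣q with prime⇒irreducible pq p∣q
... | inj₁ refl = ¬prime[1] pp
... | inj₂ p≡q  = p≢q p≡q

common-divisor∣eval : ∀ {d} f → d ∣ ∣ a f ∣ → d ∣ ∣ b f ∣ → d ∣ ∣ c f ∣ →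
                      ∀ x y → + d ℤD.∣ eval f x y
common-divisor∣eval f d∣a d∣b d∣c x y =
  ℤD.∣m∣n⇒∣m+n (ℤD.∣m∣n⇒∣m+n (ℤD.∣m⇒∣m*n (x * x) (ℤD.∣ᵤ⇒∣ {i = a f} d∣a))
                               (ℤD.∣m⇒∣m*n (x * y) (ℤD.∣ᵤ⇒∣ {i = b f} d∣b)))
               (ℤD.∣m⇒∣m*n (y * y) (ℤD.∣ᵤ⇒∣ {i = c f} d∣c))

coprime-values⇒primitive : ∀ f {m n} → Coprime m n →
                           Represents f (+ m) → Represents f (+ n) → Primitive f
coprime-values⇒primitive f cop (x₁ , y₁ , m≡) (x₂ , y₂ , n≡) =
  cop (content∣value x₁ y₁ m≡ , content∣value x₂ y₂ n≡)
  where
  ab : ℕ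
  ab = gcd ∣ a f ∣ ∣ b f ∣
  content : ℕ
  content = gcd ab ∣ c f ∣
  content∣value : ∀ {m} x y → + m ≡ eval f x y → content ∣ m
  content∣value x y m≡ = ℤD.∣⇒∣ᵤ (subst (+ content ℤD.∣_) (sym m≡) (common-divisor∣eval f
    (ℕD.∣-trans (gcd[m,n]∣m ab ∣ c f ∣) (gcd[m,n]∣m ∣ a f ∣ ∣ b f ∣))
    (ℕD.∣-trans (gcd[m,n]∣m ab ∣ c f ∣) (gcd[m,n]∣n ∣ a f ∣ ∣ b f ∣))
    (gcd[m,n]∣n ab ∣ c f ∣) x y))

reduced-representative : ∀ {f m n} → Coprime m n → PositiveDefinite f →
  Represents f (+ m) → Represents f (+ n) →
  ∃[ g ] (Reduced g × disc g ≡ disc f × Represents g (+ m) × Represents g (+ n))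
reduced-representative {f} {m} {n} cop pd rep-m rep-n with reduce f pd
... | g , f↝g , shape =
  g , (coprime-values⇒primitive g cop rep-m′ rep-n′ , pd-↝ f↝g pd , shape) , disc-≡ f↝g , rep-m′ , rep-n′
  where
  rep-m′ : Represents g (+ m)
  rep-m′ = represents-↝ f↝g rep-m
  rep-n′ : Represents g (+ n)
  rep-n′ = represents-↝ f↝g rep-n

natural-equation : ∀ {m n} x y → + m ≡ x * x + + n * (y * y) →
                   m ≡ ∣ x ∣ ℕ.* ∣ x ∣ ℕ.+ n ℕ.* (∣ y ∣ ℕ.* ∣ y ∣)
natural-equation {m} {n} x y m≡ = +-injective (begin
  + m
    ≡⟨ m≡ ⟩
  x * x + + n * (y * y)
    ≡⟨ cong₂ (λ s t → s + + n * t) (square-abs x) (square-abs y) ⟩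
  + (∣ x ∣ ℕ.* ∣ x ∣) + + n * + (∣ y ∣ ℕ.* ∣ y ∣)
    ≡⟨ cong (λ t → + (∣ x ∣ ℕ.* ∣ x ∣) + t) (sym (pos-* n _)) ⟩
  + (∣ x ∣ ℕ.* ∣ x ∣) + + (n ℕ.* (∣ y ∣ ℕ.* ∣ y ∣))
    ≡⟨ sym (pos-+ (∣ x ∣ ℕ.* ∣ x ∣) _) ⟩
  + (∣ x ∣ ℕ.* ∣ x ∣ ℕ.+ n ℕ.* (∣ y ∣ ℕ.* ∣ y ∣)) ∎)
  where open ≡-Reasoning

-- If pq = X² + n Y² for distinct primes p, q, then p ∤ Y: otherwise p ∣ X²,
-- so p ∣ X, so p² ∣ pq and p ∣ q.
prime∤second : ∀ {p q n X Y} → Prime p → Prime q → p ≢ q →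
               p ℕ.* q ≡ X ℕ.* X ℕ.+ n ℕ.* (Y ℕ.* Y) → ¬ p ∣ Y
prime∤second {p} {q} {n} {X} {Y} pp pq p≢q pq≡ p∣Y = prime∤prime pp pq p≢q (ℕD.*-cancelˡ-∣ p p²∣pq)
  where
  instance
    p≢0 : NonZero p
    p≢0 = prime⇒nonZero pp
  p∣nY² : p ∣ n ℕ.* (Y ℕ.* Y)
  p∣nY² = ℕD.∣n⇒∣m*n n (ℕD.∣m⇒∣m*n Y p∣Y)
  p∣X² : p ∣ X ℕ.* X
  p∣X² = ℕD.∣m+n∣m⇒∣n (subst (p ∣_) (trans pq≡ (ℕP.+-comm (X ℕ.* X) _)) (ℕD.m∣m*n q)) p∣nY²
  p∣X : p ∣ X
  p∣X = [ id , id ]′ (euclidsLemma X X pp p∣X²)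
  p²∣pq : p ℕ.* p ∣ p ℕ.* q
  p²∣pq = subst (p ℕ.* p ∣_) (sym pq≡)
            (ℕD.∣m∣n⇒∣m+n (ℕD.*-pres-∣ p∣X p∣X) (ℕD.∣n⇒∣m*n n (ℕD.*-pres-∣ p∣Y p∣Y)))

difference-is-one : ∀ s i t j → 1 ℕ.+ t ℕ.* j ≡ s ℕ.* i → + s * + i + (- + t) * + j ≡ + 1
difference-is-one s i t j eq = begin
  + s * + i + (- + t) * + j          ≡⟨ cong (λ e → e + (- + t) * + j) (sym lifted) ⟩
  (+ 1 + + t * + j) + (- + t) * + j  ≡⟨ drop (+ t) (+ j) ⟩
  + 1                                ∎
  where
  open ≡-Reasoning
  lifted : + 1 + + t * + j ≡ + s * + i
  lifted = begin
    + 1 + + t * + j       ≡⟨ cong (λ e → + 1 + e) (sym (pos-* t j)) ⟩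
    + 1 + + (t ℕ.* j)     ≡⟨ sym (pos-+ 1 (t ℕ.* j)) ⟩
    + (1 ℕ.+ t ℕ.* j)     ≡⟨ cong +_ eq ⟩
    + (s ℕ.* i)           ≡⟨ pos-* s i ⟩
    + s * + i             ∎
  drop : ∀ T J → (+ 1 + T * J) + (- T) * J ≡ + 1
  drop = solve-∀

bézout : ∀ {m n} → Coprime m n → ∃[ u ] ∃[ v ] (u * + m + v * + n ≡ + 1)
bézout {m} {n} cop with coprime-Bézout cop
... | Bézout.+- s t eq = + s , - + t , difference-is-one s m t n eq
... | Bézout.-+ s t eq = - + s , + t , trans (+-comm (- + s * + m) _) (difference-is-one t n s m eq)

complete-square : ∀ {P B C N} → P * C - B * B ≡ N → ∀ s t →
  P * eval (form P (+ 2 * B) C) s t ≡ (P * s + B * t) * (P * s + B * t) + N * (t * t)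
complete-square {P} {B} {C} {N} rel s t = begin
  P * eval (form P (+ 2 * B) C) s t
    ≡⟨ expand P B C s t ⟩
  (P * s + B * t) * (P * s + B * t) + (P * C - B * B) * (t * t)
    ≡⟨ cong (λ e → (P * s + B * t) * (P * s + B * t) + e * (t * t)) rel ⟩
  (P * s + B * t) * (P * s + B * t) + N * (t * t) ∎
  where
  open ≡-Reasoning
  expand : ∀ P B C s t → P * (P * (s * s) + (+ 2 * B) * (s * t) + C * (t * t))
           ≡ (P * s + B * t) * (P * s + B * t) + (P * C - B * B) * (t * t)
  expand = solve-∀

square-form-disc : ∀ P B C {N} → P * C - B * B ≡ N → disc (form P (+ 2 * B) C) ≡ - (+ 4 * N)
square-form-disc P B C rel = trans (expand P B C) (cong (λ e → - (+ 4 * e)) rel)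
  where
  expand : ∀ P B C → (+ 2 * B) * (+ 2 * B) - + 4 * P * C ≡ - (+ 4 * (P * C - B * B))
  expand = solve-∀

-- If P, N > 0 and P C − B² = N, then (P, 2B, C) is positive definite: P·f(s,t)
-- is a positive definite binary norm evaluated at (P s + B t, t), which is
-- non-zero together with (s, t).
square-form-pd : ∀ {p} B C {N} → 0ℤ < + p → 0ℤ < N → + p * C - B * B ≡ N →
                 PositiveDefinite (form (+ p) (+ 2 * B) C)
square-form-pd {p} B C {N} P>0 N>0 rel s t nonzero =
  pos-cancel p _ (subst (0ℤ <_) (sym (complete-square {+ p} {B} {C} {N} rel s t))
                                (norm-pos (+ p * s + B * t) t N>0 (shifted-nonzero nonzero)))
  where
  shifted-nonzero : s ≢ 0ℤ ⊎ t ≢ 0ℤ → + p * s + B * t ≢ 0ℤ ⊎ t ≢ 0ℤ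
  shifted-nonzero (inj₂ t≢0) = inj₂ t≢0
  shifted-nonzero (inj₁ s≢0) with t ≟ 0ℤ
  ... | no t≢0   = inj₂ t≢0
  ... | yes refl = inj₁ λ Ps≡0 → [ P≢0 , s≢0 ]′ (i*j≡0⇒i≡0∨j≡0 (+ p) (trans (sym drop-zero) Ps≡0))
    where
    P≢0 : + p ≢ 0ℤ
    P≢0 P≡0 = <-irrefl (sym P≡0) P>0
    drop-zero : + p * s + B * 0ℤ ≡ + p * s
    drop-zero = trans (cong (λ e → + p * s + e) (*-zeroʳ B)) (+-identityʳ (+ p * s))

-- If P Q = x² + N y² and u P + v y = 1, then with
--   B = x v  and  C = v² Q + N u (2 v y + u P)
-- we have P C − B² = N(u P + v y)² = N, and (P, 2B, C) takes the value Q at (x u, y).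
construction-relation : ∀ P Q N x y u v → P * Q ≡ x * x + N * (y * y) → u * P + v * y ≡ + 1 →
  P * (v * v * Q + N * u * (+ 2 * v * y + u * P)) - (x * v) * (x * v) ≡ N
construction-relation P Q N x y u v PQ≡ bez = begin
  P * (v * v * Q + N * u * (+ 2 * v * y + u * P)) - (x * v) * (x * v)
    ≡⟨ expand P Q N x y u v ⟩
  v * v * (P * Q) + N * u * P * (+ 2 * v * y + u * P) - (x * v) * (x * v)
    ≡⟨ cong (λ e → v * v * e + N * u * P * (+ 2 * v * y + u * P) - (x * v) * (x * v)) PQ≡ ⟩
  v * v * (x * x + N * (y * y)) + N * u * P * (+ 2 * v * y + u * P) - (x * v) * (x * v)
    ≡⟨ collect P N x y u v ⟩
  N * ((u * P + v * y) * (u * P + v * y))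
    ≡⟨ cong (λ e → N * (e * e)) bez ⟩
  N * (+ 1 * + 1)
    ≡⟨ unit N ⟩
  N ∎
  where
  open ≡-Reasoning
  expand : ∀ P Q N x y u v →
    P * (v * v * Q + N * u * (+ 2 * v * y + u * P)) - (x * v) * (x * v)
    ≡ v * v * (P * Q) + N * u * P * (+ 2 * v * y + u * P) - (x * v) * (x * v)
  expand = solve-∀
  collect : ∀ P N x y u v →
    v * v * (x * x + N * (y * y)) + N * u * P * (+ 2 * v * y + u * P) - (x * v) * (x * v)
    ≡ N * ((u * P + v * y) * (u * P + v * y))
  collect = solve-∀
  unit : ∀ N → N * (+ 1 * + 1) ≡ N
  unit = solve-∀

-- The value Q at (x u, y): P·f(x u, y) = (x(u P + v y))² + N y² = x² + N y² = P Q.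
construction-value : ∀ {p Q N} x y u v C → .{{NonZero p}} →
  + p * Q ≡ x * x + N * (y * y) → u * + p + v * y ≡ + 1 → + p * C - (x * v) * (x * v) ≡ N →
  Q ≡ eval (form (+ p) (+ 2 * (x * v)) C) (x * u) y
construction-value {p} {Q} {N} x y u v C PQ≡ bez rel = *-cancelˡ-≡ (+ p) _ _ (begin
  + p * Q
    ≡⟨ PQ≡ ⟩
  x * x + N * (y * y)
    ≡⟨ times-one x (N * (y * y)) ⟩
  (x * + 1) * (x * + 1) + N * (y * y)
    ≡⟨ cong (λ e → (x * e) * (x * e) + N * (y * y)) (sym bez) ⟩
  (x * (u * P + v * y)) * (x * (u * P + v * y)) + N * (y * y)
    ≡⟨ regroup P N x y u v ⟩
  (P * (x * u) + (x * v) * y) * (P * (x * u) + (x * v) * y) + N * (y * y)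
    ≡⟨ sym (complete-square {P} {x * v} {C} {N} rel (x * u) y) ⟩
  P * eval (form P (+ 2 * (x * v)) C) (x * u) y ∎)
  where
  open ≡-Reasoning
  P : ℤ
  P = + p
  times-one : ∀ x z → x * x + z ≡ (x * + 1) * (x * + 1) + z
  times-one = solve-∀
  regroup : ∀ P N x y u v →
    (x * (u * P + v * y)) * (x * (u * P + v * y)) + N * (y * y)
    ≡ (P * (x * u) + (x * v) * y) * (P * (x * u) + (x * v) * y) + N * (y * y)
  regroup = solve-∀

representing-form : ∀ p Q N x y u v → .{{NonZero p}} → 0ℤ < N →
  + p * Q ≡ x * x + N * (y * y) → u * + p + v * y ≡ + 1 →
  ∃[ f ] (PositiveDefinite f × disc f ≡ - (+ 4 * N) × Represents f (+ p) × Represents f Q)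
representing-form p Q N x y u v N>0 PQ≡ bez =
  form (+ p) (+ 2 * B) C , square-form-pd B C P>0 N>0 rel , square-form-disc (+ p) B C rel ,
  (+ 1 , + 0 , sym (eval-at-1,0 (+ p) (+ 2 * B) C)) , (x * u , y , construction-value x y u v C PQ≡ bez rel)
  where
  B C : ℤ
  B = x * v
  C = v * v * Q + N * u * (+ 2 * v * y + u * + p)
  rel : + p * C - B * B ≡ N
  rel = construction-relation (+ p) Q N x y u v PQ≡ bez
  P>0 : 0ℤ < + p
  P>0 = +<+ (ℕ.>-nonZero⁻¹ p)

pq-norm⇒reduced-form : ∀ n p q → NonZero n → Prime p → Prime q → p ≢ q →
  (∃[ x ] ∃[ y ] (+ (p ℕ.* q) ≡ x * x + + n * (y * y))) →
  ∃[ f ] (Reduced f × disc f ≡ - (+ (4 ℕ.* n)) × Represents f (+ p) × Represents f (+ q))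
pq-norm⇒reduced-form n p q n≢0 pp pq p≢q (x , y , pq≡) =
  let (u , v , bez) = bézout (prime∤⇒coprime pp p∤y)
      (f , pd , disc-f , rep-p , rep-q) = representing-form p (+ q) (+ n) x |y| u v N>0 pq≡′ bez
      (g , reduced , disc-g , rep-p′ , rep-q′) =
        reduced-representative {f} (prime∤⇒coprime pp (prime∤prime pp pq p≢q)) pd rep-p rep-q
  in g , reduced , trans disc-g (trans disc-f (cong -_ (sym (pos-* 4 n)))) , rep-p′ , rep-q′
  where
  instance
    p≢0 : NonZero p
    p≢0 = prime⇒nonZero pp
  N>0 : 0ℤ < + n
  N>0 = +<+ (ℕ.>-nonZero⁻¹ n {{n≢0}})
  p∤y : ¬ p ∣ ∣ y ∣
  p∤y = prime∤second {n = n} {X = ∣ x ∣} pp pq p≢q (natural-equation {n = n} x y pq≡)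
  |y| : ℤ
  |y| = + ∣ y ∣
  pq≡′ : + p * + q ≡ x * x + + n * (|y| * |y|)
  pq≡′ = trans (sym (pos-* p q)) (trans pq≡
           (cong (λ e → x * x + + n * e) (trans (square-abs y) (pos-* ∣ y ∣ ∣ y ∣))))

-- Discriminant −4n forces an even middle coefficient: for odd b the
-- discriminant b² − 4ac is odd.
even-middle : ∀ A B C n → B * B - + 4 * A * C ≡ - (+ (4 ℕ.* n)) → ∃[ h ] (B ≡ + 2 * h)
even-middle A B C n disc≡ with B %ℕ 2 | a≡a%ℕn+[a/ℕn]*n B 2 | n%ℕd<d B 2
... | 0               | B≡ | _ = B /ℕ 2 , trans B≡ (trans (+-identityˡ _) (*-comm (B /ℕ 2) (+ 2)))
... | ℕ.suc (ℕ.suc _) | _  | ℕ.s≤s (ℕ.s≤s ())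
... | 1               | B≡ | _ = ⊥-elim (one≢even (- (+ 2 * + n) - + 2 * e) one-is-even)
  where
  open ≡-Reasoning
  h e : ℤ
  h = B /ℕ 2
  e = h + h * h - A * C
  odd-disc : (+ 1 + h * + 2) * (+ 1 + h * + 2) - + 4 * A * C ≡ - (+ (4 ℕ.* n))
  odd-disc = subst (λ β → β * β - + 4 * A * C ≡ - (+ (4 ℕ.* n))) B≡ disc≡
  odd-square : ∀ h A C →
    + 1 ≡ ((+ 1 + h * + 2) * (+ 1 + h * + 2) - + 4 * A * C) - + 2 * (+ 2 * (h + h * h - A * C))
  odd-square = solve-∀
  factor-two : ∀ n e → - (+ 4 * n) - + 2 * (+ 2 * e) ≡ + 2 * (- (+ 2 * n) - + 2 * e)
  factor-two = solve-∀
  one-is-even : + 1 ≡ + 2 * (- (+ 2 * + n) - + 2 * e)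
  one-is-even = begin
    + 1
      ≡⟨ odd-square h A C ⟩
    ((+ 1 + h * + 2) * (+ 1 + h * + 2) - + 4 * A * C) - + 2 * (+ 2 * e)
      ≡⟨ cong (λ d → d - + 2 * (+ 2 * e)) odd-disc ⟩
    - (+ (4 ℕ.* n)) - + 2 * (+ 2 * e)
      ≡⟨ cong (λ d → - d - + 2 * (+ 2 * e)) (pos-* 4 n) ⟩
    - (+ 4 * + n) - + 2 * (+ 2 * e)
      ≡⟨ factor-two (+ n) e ⟩
    + 2 * (- (+ 2 * + n) - + 2 * e) ∎

determinant : ∀ A h C n → (+ 2 * h) * (+ 2 * h) - + 4 * A * C ≡ - (+ (4 ℕ.* n)) → A * C - h * h ≡ + n
determinant A h C n disc≡ = *-cancelˡ-≡ (+ 4) _ _ (begin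
  + 4 * (A * C - h * h)                         ≡⟨ expand A h C ⟩
  - ((+ 2 * h) * (+ 2 * h) - + 4 * A * C)       ≡⟨ cong -_ disc≡ ⟩
  - - (+ (4 ℕ.* n))                             ≡⟨ neg-involutive _ ⟩
  + (4 ℕ.* n)                                   ≡⟨ pos-* 4 n ⟩
  + 4 * + n                                     ∎)
  where
  open ≡-Reasoning
  expand : ∀ A h C → + 4 * (A * C - h * h) ≡ - ((+ 2 * h) * (+ 2 * h) - + 4 * A * C)
  expand = solve-∀

composition : ∀ A h C x₁ y₁ x₂ y₂ →
  (A * (x₁ * x₁) + (+ 2 * h) * (x₁ * y₁) + C * (y₁ * y₁)) * (A * (x₂ * x₂) + (+ 2 * h) * (x₂ * y₂) + C * (y₂ * y₂))
  ≡ (A * x₁ * x₂ + h * (x₁ * y₂ + x₂ * y₁) + C * y₁ * y₂) * (A * x₁ * x₂ + h * (x₁ * y₂ + x₂ * y₁) + C * y₁ * y₂)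
    + (A * C - h * h) * ((x₂ * y₁ - x₁ * y₂) * (x₂ * y₁ - x₁ * y₂))
composition = solve-∀

form-values⇒pq-norm : ∀ n p q f → disc f ≡ - (+ (4 ℕ.* n)) → Represents f (+ p) → Represents f (+ q) →
  ∃[ x ] ∃[ y ] (+ (p ℕ.* q) ≡ x * x + + n * (y * y))
form-values⇒pq-norm n p q (form A B C) disc≡ (x₁ , y₁ , p≡) (x₂ , y₂ , q≡)
  with even-middle A B C n disc≡
... | h , refl = X , Y , (begin
  + (p ℕ.* q)
    ≡⟨ pos-* p q ⟩
  + p * + q
    ≡⟨ cong₂ _*_ p≡ q≡ ⟩
  eval (form A (+ 2 * h) C) x₁ y₁ * eval (form A (+ 2 * h) C) x₂ y₂
    ≡⟨ composition A h C x₁ y₁ x₂ y₂ ⟩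
  X * X + (A * C - h * h) * (Y * Y)
    ≡⟨ cong (λ d → X * X + d * (Y * Y)) (determinant A h C n disc≡) ⟩
  X * X + + n * (Y * Y) ∎)
  where
  open ≡-Reasoning
  X Y : ℤ
  X = A * x₁ * x₂ + h * (x₁ * y₂ + x₂ * y₁) + C * y₁ * y₂
  Y = x₂ * y₁ - x₁ * y₂

theorem4p1 : (n p q : ℕ) → NonZero n →
    Prime p → Prime q → p ≢ q → ¬ (2 ∣ p) → ¬ (2 ∣ q) → ¬ (p ∣ n) → ¬ (q ∣ n) →
    (∃[ x ] ∃[ y ] (+ (p Data.Nat.* q) ≡ x * x + + n * (y * y)))
      ⇔ (∃[ f ] (Reduced f × disc f ≡ - (+ (4 Data.Nat.* n)) × Represents f (+ p) × Represents f (+ q)))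
theorem4p1 n p q n≢0 pp pq p≢q _ _ _ _ =
  mk⇔ (pq-norm⇒reduced-form n p q n≢0 pp pq p≢q)
      (λ (f , _ , disc≡ , rep-p , rep-q) → form-values⇒pq-norm n p q f disc≡ rep-p rep-q)
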